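{- For $\mathsf{S}\in\{\mathsf{G4CK},\mathsf{G4WK}\}$, the following rules are admissible in $\mathsf{S}$, for all finite multisets $\Gamma,\Pi$, formulas $\varphi,\psi$ and succedents $\Delta$ allowed in $\mathsf{S}$: (wk) if $\vdash_{\mathsf{S}}\Gamma\Rightarrow\Delta$ then $\vdash_{\mathsf{S}}\Gamma,\Pi\Rightarrow\Delta$; (Id) $\vdash_{\mathsf{S}}\Gamma,\varphi\Rightarrow\varphi$; ($\to$L) if $\vdash_{\mathsf{S}}\Gamma\Rightarrow\varphi$ and $\vdash_{\mathsf{S}}\psi,\Gamma\Rightarrow\Delta$ then $\vdash_{\mathsf{S}}\Gamma,\varphi\to\psi\Rightarrow\Delta$.
   Context: Formulas are built from a countably infinite set $\mathsf{Prop}$ of propositional variables by $\varphi ::= p \mid \bot \mid \varphi\wedge\varphi \mid \varphi\vee\varphi \mid \varphi\to\varphi \mid \Box\varphi \mid \Diamond\varphi$. For a multiset $\Gamma$, $\Box^{ -1}\Gamma=\{\varphi\mid\Box\varphi\in\Gamma\}$ and $\Diamond^{ -1}\Gamma=\{\varphi\mid\Diamond\varphi\in\Gamma\}$ (with multiplicities). A sequent is $\Gamma\Rightarrow\Delta$ with $\Gamma,\Delta$ finite multisets of formulas; $\Gamma,\varphi$ means $\Gamma\uplus\{\varphi\}$ and $\Gamma,\Pi$ means $\Gamma\uplus\Pi$; a single formula on the right denotes a singleton. In $\mathsf{G4CK}$ succedents have exactly one element; in $\mathsf{G4WK}$ at most one. Common rules ($p\in\mathsf{Prop}$, $\Delta$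 an allowed succedent): ($\bot$L) $\Gamma,\bot\Rightarrow\Delta$ (no premises); (IdP) $\Gamma,p\Rightarrow p$ (no premises); ($\wedge$L) from $\Gamma,\varphi,\psi\Rightarrow\Delta$ infer $\Gamma,\varphi\wedge\psi\Rightarrow\Delta$; ($\wedge$R) from $\Gamma\Rightarrow\varphi$, $\Gamma\Rightarrow\psi$ infer $\Gamma\Rightarrow\varphi\wedge\psi$; ($\vee$L) from $\Gamma,\varphi\Rightarrow\Delta$, $\Gamma,\psi\Rightarrow\Delta$ infer $\Gamma,\varphi\vee\psi\Rightarrow\Delta$; ($\vee$R$_i$) from $\Gamma\Rightarrow\varphi_i$ infer $\Gamma\Rightarrow\varphi_1\vee\varphi_2$; ($\to$R) from $\Gamma,\varphi\Rightarrow\psi$ infer $\Gamma\Rightarrow\varphi\to\psi$; ($\wedge\!\to$L) from $\Gamma,\varphi\to(\psi\to\chi)\Rightarrow\Delta$ infer $\Gamma,(\varphi\wedge\psi)\to\chi\Rightarrow\Delta$; ($\vee\!\to$L) from $\Gamma,\varphi\to\chi,\psi\to\chi\Rightarrow\Delta$ infer $\Gamma,(\varphi\vee\psi)\to\chi\Rightarrow\Delta$; ($p\!\to$L) from $\Gamma,p,\varphi\Rightarrow\Delta$ infer $\Gamma,p,p\to\varphi\Rightarrow\Delta$; ($\to\to$L) from $\Gamma,\psi\to\chi\Rightarrow\varphi\to\psi$ and $\Gamma,\chi\Rightarrow\Delta$ infer $\Gamma,(\varphi\to\psi)\to\chi\Rightarrow\Delta$; ($\Box$R) from $\Box^{ -1}\Gamma\Rightarrow\varphi$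 infer $\Gamma\Rightarrow\Box\varphi$; ($\Box\!\to$L) from $\Box^{ -1}\Gamma\Rightarrow\varphi$ and $\Gamma,\psi\Rightarrow\Delta$ infer $\Gamma,\Box\varphi\to\psi\Rightarrow\Delta$; ($\Diamond\!\to$L) from $\Box^{ -1}\Gamma,\gamma\Rightarrow\varphi$ and $\Gamma,\Diamond\gamma,\psi\Rightarrow\Delta$ infer $\Gamma,\Diamond\gamma,\Diamond\varphi\to\psi\Rightarrow\Delta$. $\mathsf{G4CK}$ additionally has ($\Diamond$L): from $\Box^{ -1}\Gamma,\varphi\Rightarrow\psi$ infer $\Gamma,\Diamond\varphi\Rightarrow\Diamond\psi$; $\mathsf{G4WK}$ instead has ($\Diamond$L$'$): from $\Box^{ -1}\Gamma,\varphi\Rightarrow\Diamond^{ -1}\Delta$ infer $\Gamma,\Diamond\varphi\Rightarrow\Delta$. $\vdash_{\mathsf{S}}\Gamma\Rightarrow\Delta$ means the sequent has a finite derivation in $\mathsf{S}$. -}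

module Defs where

open import Data.Nat using (ℕ)
open import Data.List using (List; []; _∷_; _++_; [_]; mapMaybe)
open import Data.Maybe using (Maybe; just; nothing)
open import Data.List.Relation.Binary.Permutation.Propositional using (_↭_)

infixr 6 _∧'_
infixr 5 _∨'_
infixr 4 _⇒'_
data Fm : Set where
  var  : ℕ → Fm
  ⊥'   : Fm
  _∧'_ : Fm → Fm → Fm
  _∨'_ : Fm → Fm → Fm
  _⇒'_ : Fm → Fm → Fm
  □    : Fm → Fm
  ◇    : Fm → Fm

data Sys : Set where
  CK WK : Sys

-- Allowed succedents: exactly one formula in G4CK, at most one in G4WK.
Succ : Sys → Set
Succ CK = Fm
Succ WK = Maybe Fm

sing : (S : Sys) → Fm → Succ S
sing CK φ = φ
sing WK φ = just φ

unbox : Fm → Maybe Fm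
unbox (□ φ) = just φ
unbox _     = nothing

□⁻¹ : List Fm → List Fm
□⁻¹ Γ = mapMaybe unbox Γ

◇⁻¹ : Maybe Fm → Maybe Fm
◇⁻¹ (just (◇ φ)) = just φ
◇⁻¹ _            = nothing

-- Derivability.  Antecedent multisets are represented by lists; every rule
-- conclusion "Γ, stuff ⇒ Δ" may be any list Θ that is a permutation of
-- Γ ++ stuff, so derivability concerns multisets.
data _⊢_⇒_ : (S : Sys) → List Fm → Succ S → Set where
  ⊥L   : ∀ {S Θ Γ} {Δ : Succ S} → Θ ↭ Γ ++ [ ⊥' ] → S ⊢ Θ ⇒ Δ
  IdP  : ∀ {S Θ Γ p} → Θ ↭ Γ ++ [ var p ] → S ⊢ Θ ⇒ sing S (var p)
  ∧L   : ∀ {S Θ Γ φ ψ} {Δ : Succ S} → Θ ↭ Γ ++ [ φ ∧' ψ ] →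
         S ⊢ Γ ++ φ ∷ ψ ∷ [] ⇒ Δ → S ⊢ Θ ⇒ Δ
  ∧R   : ∀ {S Γ φ ψ} → S ⊢ Γ ⇒ sing S φ → S ⊢ Γ ⇒ sing S ψ →
         S ⊢ Γ ⇒ sing S (φ ∧' ψ)
  ∨L   : ∀ {S Θ Γ φ ψ} {Δ : Succ S} → Θ ↭ Γ ++ [ φ ∨' ψ ] →
         S ⊢ Γ ++ [ φ ] ⇒ Δ → S ⊢ Γ ++ [ ψ ] ⇒ Δ → S ⊢ Θ ⇒ Δ
  ∨R₁  : ∀ {S Γ φ ψ} → S ⊢ Γ ⇒ sing S φ → S ⊢ Γ ⇒ sing S (φ ∨' ψ)
  ∨R₂  : ∀ {S Γ φ ψ} → S ⊢ Γ ⇒ sing S ψ → S ⊢ Γ ⇒ sing S (φ ∨' ψ)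
  ⇒R   : ∀ {S Γ φ ψ} → S ⊢ Γ ++ [ φ ] ⇒ sing S ψ → S ⊢ Γ ⇒ sing S (φ ⇒' ψ)
  ∧⇒L  : ∀ {S Θ Γ φ ψ χ} {Δ : Succ S} → Θ ↭ Γ ++ [ (φ ∧' ψ) ⇒' χ ] →
         S ⊢ Γ ++ [ φ ⇒' (ψ ⇒' χ) ] ⇒ Δ → S ⊢ Θ ⇒ Δ
  ∨⇒L  : ∀ {S Θ Γ φ ψ χ} {Δ : Succ S} → Θ ↭ Γ ++ [ (φ ∨' ψ) ⇒' χ ] →
         S ⊢ Γ ++ (φ ⇒' χ) ∷ (ψ ⇒' χ) ∷ [] ⇒ Δ → S ⊢ Θ ⇒ Δ
  p⇒L  : ∀ {S Θ Γ p φ} {Δ : Succ S} → Θ ↭ Γ ++ var p ∷ (var p ⇒' φ) ∷ [] →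
         S ⊢ Γ ++ var p ∷ φ ∷ [] ⇒ Δ → S ⊢ Θ ⇒ Δ
  ⇒⇒L  : ∀ {S Θ Γ φ ψ χ} {Δ : Succ S} → Θ ↭ Γ ++ [ (φ ⇒' ψ) ⇒' χ ] →
         S ⊢ Γ ++ [ ψ ⇒' χ ] ⇒ sing S (φ ⇒' ψ) →
         S ⊢ Γ ++ [ χ ] ⇒ Δ → S ⊢ Θ ⇒ Δ
  □R   : ∀ {S Γ φ} → S ⊢ □⁻¹ Γ ⇒ sing S φ → S ⊢ Γ ⇒ sing S (□ φ)
  □⇒L  : ∀ {S Θ Γ φ ψ} {Δ : Succ S} → Θ ↭ Γ ++ [ □ φ ⇒' ψ ] →
         S ⊢ □⁻¹ Γ ⇒ sing S φ → S ⊢ Γ ++ [ ψ ] ⇒ Δ → S ⊢ Θ ⇒ Δ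
  ◇⇒L  : ∀ {S Θ Γ γ φ ψ} {Δ : Succ S} → Θ ↭ Γ ++ ◇ γ ∷ (◇ φ ⇒' ψ) ∷ [] →
         S ⊢ □⁻¹ Γ ++ [ γ ] ⇒ sing S φ →
         S ⊢ Γ ++ ◇ γ ∷ ψ ∷ [] ⇒ Δ → S ⊢ Θ ⇒ Δ
  ◇L   : ∀ {Θ Γ φ ψ} → Θ ↭ Γ ++ [ ◇ φ ] →
         CK ⊢ □⁻¹ Γ ++ [ φ ] ⇒ ψ → CK ⊢ Θ ⇒ ◇ ψ
  ◇L'  : ∀ {Θ Γ φ} {Δ : Maybe Fm} → Θ ↭ Γ ++ [ ◇ φ ] →
         WK ⊢ □⁻¹ Γ ++ [ φ ] ⇒ ◇⁻¹ Δ → WK ⊢ Θ ⇒ Δ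

-- Weakening (together with exchange) holds by induction on derivations, since □⁻¹ distributes
-- over ++.  The left rules for ∧, ∨ and implications are invertible, the two-premise ones with
-- respect to the premise that keeps the context.  ⇒L is admissible by induction on φ and then
-- on the derivation of Γ ⇒ φ: a final left rule commutes with ⇒L once the hypothesis ψ, Γ ⇒ Δ
-- is inverted at the same principal formula, and a final right rule for φ is replaced by the G4
-- left rule for φ → ψ of the matching shape, using ⇒L for the components of φ when φ is a
-- conjunction or a disjunction.  Identity follows by induction on φ, using ⇒L for implications.
module Submission where

open import Defs
open import Data.List using (List; _∷_; _++_; [_]; [])
open import Data.List.Properties using (mapMaybe-++)
open import Data.Product using (_×_; _,_)
open import Data.Sum using (inj₁; inj₂)
open import Data.Maybe using (Maybe; just; nothing)
open import Data.Unit using (⊤; tt)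
open import Relation.Binary.PropositionalEquality using (_≡_; refl; sym; cong)
open import Data.List.Relation.Unary.Any using (here)
open import Data.List.Membership.Propositional.Properties using (∈-++⁺ʳ; ∈-++⁻; ∈-∃++)
open import Data.List.Relation.Binary.Permutation.Propositional
open import Data.List.Relation.Binary.Permutation.Propositional.Properties

module _ {a} {A : Set a} where

  ++-swapʳ : ∀ (Γ X Y : List A) → (Γ ++ X) ++ Y ↭ (Γ ++ Y) ++ X
  ++-swapʳ Γ X Y = begin
    (Γ ++ X) ++ Y  ↭⟨ ++-assoc Γ X Y ⟩
    Γ ++ (X ++ Y)  ↭⟨ ++⁺ˡ Γ (++-comm X Y) ⟩
    Γ ++ (Y ++ X)  ↭⟨ ↭-sym (++-assoc Γ Y X) ⟩
    (Γ ++ Y) ++ X  ∎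
    where open PermutationReasoning

  ↭-++-insert : ∀ {Θ} Γ {X} (Y : List A) → Θ ↭ Γ ++ X → Θ ++ Y ↭ (Γ ++ Y) ++ X
  ↭-++-insert Γ {X} Y p = trans (++⁺ʳ Y p) (++-swapʳ Γ X Y)

  ↭-snoc : ∀ {Θ Γ} {x} (y : A) → Θ ↭ Γ ++ [ x ] → Θ ++ [ y ] ↭ Γ ++ x ∷ y ∷ []
  ↭-snoc {Γ = Γ} {x} y p = trans (++⁺ʳ [ y ] p) (++-assoc Γ [ x ] [ y ])

  ↭-cons-snoc : ∀ {Θ Γ} {x} (y : A) → Θ ↭ Γ ++ [ x ] → y ∷ Θ ↭ Γ ++ x ∷ y ∷ []
  ↭-cons-snoc {Θ} y p = trans (∷↭∷ʳ y Θ) (↭-snoc y p)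

  drop-last : ∀ {Γ Γ'} {x : A} → Γ ++ [ x ] ↭ Γ' ++ [ x ] → Γ ↭ Γ'
  drop-last {Γ} {Γ'} {x} p = drop-∷ (trans (∷↭∷ʳ x Γ) (trans p (↭-sym (∷↭∷ʳ x Γ'))))

  data Split : List A → A → List A → A → Set a where
    same    : ∀ {Γ Γ' x} → Γ ↭ Γ' → Split Γ x Γ' x
    crossed : ∀ {Γ Γ' x y} Γ₀ → Γ ↭ Γ₀ ++ [ y ] → Γ' ↭ Γ₀ ++ [ x ] → Split Γ x Γ' y

  split : ∀ {Γ Γ'} {x y : A} → Γ ++ [ x ] ↭ Γ' ++ [ y ] → Split Γ x Γ' y
  split {Γ} {Γ'} {x} {y} p with ∈-++⁻ Γ' (∈-resp-↭ p (∈-++⁺ʳ Γ (here refl)))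
  ... | inj₂ (here refl) = same (drop-last p)
  ... | inj₁ x∈Γ' with ys , zs , refl ← ∈-∃++ x∈Γ' = crossed (ys ++ zs) Γ↭ Γ'↭
    where
      Γ'↭ : ys ++ [ x ] ++ zs ↭ (ys ++ zs) ++ [ x ]
      Γ'↭ = trans (shift x ys zs) (∷↭∷ʳ x (ys ++ zs))
      Γ↭ : Γ ↭ (ys ++ zs) ++ [ y ]
      Γ↭ = drop-last (trans p (trans (++⁺ʳ [ y ] Γ'↭) (++-swapʳ (ys ++ zs) [ x ] [ y ])))

  data Split₂ : List A → A → List A → A → A → Set a where
    first    : ∀ {Γ Γ' x y} → Γ ↭ Γ' ++ [ y ] → Split₂ Γ x Γ' x y
    second   : ∀ {Γ Γ' x y} → Γ ↭ Γ' ++ [ x ] → Split₂ Γ y Γ' x y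
    crossed₂ : ∀ {Γ Γ' b x y} Γ₀ → Γ ↭ Γ₀ ++ x ∷ y ∷ [] → Γ' ↭ Γ₀ ++ [ b ] → Split₂ Γ b Γ' x y

  split₂ : ∀ {Γ Γ'} {b x y : A} → Γ ++ [ b ] ↭ Γ' ++ x ∷ y ∷ [] → Split₂ Γ b Γ' x y
  split₂ {Γ' = Γ'} {x = x} {y} p with split (trans p (↭-sym (++-assoc Γ' [ x ] [ y ])))
  ... | same r = second r
  ... | crossed Γ₀ r₁ r₂ with split r₂
  ...   | same s = first (trans r₁ (++⁺ʳ [ y ] (↭-sym s)))
  ...   | crossed Γ₁ s₁ s₂ = crossed₂ Γ₁ (trans r₁ (↭-snoc y s₂)) s₁

□⁻¹-++ : ∀ Γ Π → □⁻¹ (Γ ++ Π) ≡ □⁻¹ Γ ++ □⁻¹ Π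
□⁻¹-++ = mapMaybe-++ unbox

□⁻¹-↭ : ∀ {Γ Γ'} → Γ ↭ Γ' → □⁻¹ Γ ↭ □⁻¹ Γ'
□⁻¹-↭ = mapMaybe-↭ unbox

□⁻¹-insert : ∀ Γ Π {Ys} → □⁻¹ (Γ ++ Π) ++ Ys ↭ (□⁻¹ Γ ++ Ys) ++ □⁻¹ Π
□⁻¹-insert Γ Π = ↭-++-insert (□⁻¹ Γ) _ (↭-reflexive (□⁻¹-++ Γ Π))

weaken : ∀ {S Θ Θ'} {Δ : Succ S} → S ⊢ Θ ⇒ Δ → ∀ Π → Θ' ↭ Θ ++ Π → S ⊢ Θ' ⇒ Δ
weaken (⊥L {Γ = Γ} p) Π q = ⊥L (trans q (↭-++-insert Γ Π p))
weaken (IdP {Γ = Γ} p) Π q = IdP (trans q (↭-++-insert Γ Π p))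
weaken (∧L {Γ = Γ} p d) Π q = ∧L (trans q (↭-++-insert Γ Π p)) (weaken d Π (++-swapʳ Γ Π _))
weaken (∧R d₁ d₂) Π q = ∧R (weaken d₁ Π q) (weaken d₂ Π q)
weaken (∨L {Γ = Γ} p d₁ d₂) Π q =
  ∨L (trans q (↭-++-insert Γ Π p)) (weaken d₁ Π (++-swapʳ Γ Π _)) (weaken d₂ Π (++-swapʳ Γ Π _))
weaken (∨R₁ d) Π q = ∨R₁ (weaken d Π q)
weaken (∨R₂ d) Π q = ∨R₂ (weaken d Π q)
weaken (⇒R {Γ = Γ} d) Π q = ⇒R (weaken d Π (↭-++-insert Γ _ q))
weaken (∧⇒L {Γ = Γ} p d) Π q = ∧⇒L (trans q (↭-++-insert Γ Π p)) (weaken d Π (++-swapʳ Γ Π _))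
weaken (∨⇒L {Γ = Γ} p d) Π q = ∨⇒L (trans q (↭-++-insert Γ Π p)) (weaken d Π (++-swapʳ Γ Π _))
weaken (p⇒L {Γ = Γ} p d) Π q = p⇒L (trans q (↭-++-insert Γ Π p)) (weaken d Π (++-swapʳ Γ Π _))
weaken (⇒⇒L {Γ = Γ} p d₁ d₂) Π q =
  ⇒⇒L (trans q (↭-++-insert Γ Π p)) (weaken d₁ Π (++-swapʳ Γ Π _)) (weaken d₂ Π (++-swapʳ Γ Π _))
weaken (□R {Γ = Γ} d) Π q = □R (weaken d (□⁻¹ Π) (trans (□⁻¹-↭ q) (↭-reflexive (□⁻¹-++ Γ Π))))
weaken (□⇒L {Γ = Γ} p d₁ d₂) Π q =
  □⇒L (trans q (↭-++-insert Γ Π p)) (weaken d₁ (□⁻¹ Π) (↭-reflexive (□⁻¹-++ Γ Π)))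
      (weaken d₂ Π (++-swapʳ Γ Π _))
weaken (◇⇒L {Γ = Γ} p d₁ d₂) Π q =
  ◇⇒L (trans q (↭-++-insert Γ Π p)) (weaken d₁ (□⁻¹ Π) (□⁻¹-insert Γ Π))
      (weaken d₂ Π (++-swapʳ Γ Π _))
weaken (◇L {Γ = Γ} p d) Π q = ◇L (trans q (↭-++-insert Γ Π p)) (weaken d (□⁻¹ Π) (□⁻¹-insert Γ Π))
weaken (◇L' {Γ = Γ} p d) Π q = ◇L' (trans q (↭-++-insert Γ Π p)) (weaken d (□⁻¹ Π) (□⁻¹-insert Γ Π))

exchange : ∀ {S Θ Θ'} {Δ : Succ S} → S ⊢ Θ ⇒ Δ → Θ ↭ Θ' → S ⊢ Θ' ⇒ Δ
exchange {Θ = Θ} d q = weaken d [] (trans (↭-sym q) (↭-sym (++-identityʳ Θ)))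

weakenʳ : ∀ {Θ} {Δ : Maybe Fm} → WK ⊢ Θ ⇒ nothing → WK ⊢ Θ ⇒ Δ
weakenʳ (⊥L p) = ⊥L p
weakenʳ (∧L p d) = ∧L p (weakenʳ d)
weakenʳ (∨L p d₁ d₂) = ∨L p (weakenʳ d₁) (weakenʳ d₂)
weakenʳ (∧⇒L p d) = ∧⇒L p (weakenʳ d)
weakenʳ (∨⇒L p d) = ∨⇒L p (weakenʳ d)
weakenʳ (p⇒L p d) = p⇒L p (weakenʳ d)
weakenʳ (⇒⇒L p d₁ d₂) = ⇒⇒L p d₁ (weakenʳ d₂)
weakenʳ (□⇒L p d₁ d₂) = □⇒L p d₁ (weakenʳ d₂)
weakenʳ (◇⇒L p d₁ d₂) = ◇⇒L p d₁ (weakenʳ d₂)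
weakenʳ (◇L' p d) = ◇L' p (weakenʳ d)

-- For the two-premise rules only the premise with the context of the conclusion is inverted.
data Invertible : Fm → List Fm → Set where
  inv-∧  : ∀ {α β} → Invertible (α ∧' β) (α ∷ β ∷ [])
  inv-∨₁ : ∀ {α β} → Invertible (α ∨' β) [ α ]
  inv-∨₂ : ∀ {α β} → Invertible (α ∨' β) [ β ]
  inv-∧⇒ : ∀ {α β χ} → Invertible ((α ∧' β) ⇒' χ) [ α ⇒' (β ⇒' χ) ]
  inv-∨⇒ : ∀ {α β χ} → Invertible ((α ∨' β) ⇒' χ) ((α ⇒' χ) ∷ (β ⇒' χ) ∷ [])
  inv-p⇒ : ∀ {p χ} → Invertible (var p ⇒' χ) [ χ ]
  inv-⇒⇒ : ∀ {α β χ} → Invertible ((α ⇒' β) ⇒' χ) [ χ ]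
  inv-□⇒ : ∀ {α χ} → Invertible (□ α ⇒' χ) [ χ ]
  inv-◇⇒ : ∀ {α χ} → Invertible (◇ α ⇒' χ) [ χ ]

□⁻¹-invertible : ∀ {B Bs} → Invertible B Bs → □⁻¹ [ B ] ≡ []
□⁻¹-invertible inv-∧ = refl
□⁻¹-invertible inv-∨₁ = refl
□⁻¹-invertible inv-∨₂ = refl
□⁻¹-invertible inv-∧⇒ = refl
□⁻¹-invertible inv-∨⇒ = refl
□⁻¹-invertible inv-p⇒ = refl
□⁻¹-invertible inv-⇒⇒ = refl
□⁻¹-invertible inv-□⇒ = refl
□⁻¹-invertible inv-◇⇒ = refl

□⁻¹-inverted : ∀ {Γ Γ₀ B Bs} → Invertible B Bs → Γ ↭ Γ₀ ++ [ B ] → □⁻¹ (Γ₀ ++ Bs) ↭ □⁻¹ Γ ++ □⁻¹ Bs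
□⁻¹-inverted {Γ} {Γ₀} {B} {Bs} i q = begin
  □⁻¹ (Γ₀ ++ Bs)              ≡⟨ □⁻¹-++ Γ₀ Bs ⟩
  □⁻¹ Γ₀ ++ □⁻¹ Bs            ↭⟨ ++⁺ʳ _ (++-identityʳ (□⁻¹ Γ₀)) ⟨
  (□⁻¹ Γ₀ ++ []) ++ □⁻¹ Bs    ≡⟨ cong (λ Ξ → (□⁻¹ Γ₀ ++ Ξ) ++ □⁻¹ Bs) (□⁻¹-invertible i) ⟨
  (□⁻¹ Γ₀ ++ □⁻¹ [ B ]) ++ □⁻¹ Bs ≡⟨ cong (_++ □⁻¹ Bs) (□⁻¹-++ Γ₀ [ B ]) ⟨
  □⁻¹ (Γ₀ ++ [ B ]) ++ □⁻¹ Bs ↭⟨ ++⁺ʳ _ (□⁻¹-↭ q) ⟨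
  □⁻¹ Γ ++ □⁻¹ Bs             ∎
  where open PermutationReasoning

invert : ∀ {S Θ B Bs} {Δ : Succ S} Γ → Invertible B Bs →
         S ⊢ Θ ⇒ Δ → Θ ↭ Γ ++ [ B ] → S ⊢ Γ ++ Bs ⇒ Δ
invert Γ i (⊥L p) q with split (trans (↭-sym q) p)
invert Γ () (⊥L p) q | same _
... | crossed Γ₀ r₁ _ = ⊥L (↭-++-insert Γ₀ _ r₁)
invert Γ i (IdP p) q with split (trans (↭-sym q) p)
invert Γ () (IdP p) q | same _
... | crossed Γ₀ r₁ _ = IdP (↭-++-insert Γ₀ _ r₁)
invert Γ i (∧L p d) q with split (trans (↭-sym q) p)
invert Γ inv-∧ (∧L p d) q | same r = exchange d (++⁺ʳ _ (↭-sym r))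
... | crossed Γ₀ r₁ r₂ =
  ∧L (↭-++-insert Γ₀ _ r₁) (exchange (invert _ i d (↭-++-insert Γ₀ _ r₂)) (++-swapʳ Γ₀ _ _))
invert Γ i (∧R d₁ d₂) q = ∧R (invert Γ i d₁ q) (invert Γ i d₂ q)
invert Γ i (∨L p d₁ d₂) q with split (trans (↭-sym q) p)
invert Γ inv-∨₁ (∨L p d₁ d₂) q | same r = exchange d₁ (++⁺ʳ _ (↭-sym r))
invert Γ inv-∨₂ (∨L p d₁ d₂) q | same r = exchange d₂ (++⁺ʳ _ (↭-sym r))
... | crossed Γ₀ r₁ r₂ =
  ∨L (↭-++-insert Γ₀ _ r₁) (exchange (invert _ i d₁ (↭-++-insert Γ₀ _ r₂)) (++-swapʳ Γ₀ _ _))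
     (exchange (invert _ i d₂ (↭-++-insert Γ₀ _ r₂)) (++-swapʳ Γ₀ _ _))
invert Γ i (∨R₁ d) q = ∨R₁ (invert Γ i d q)
invert Γ i (∨R₂ d) q = ∨R₂ (invert Γ i d q)
invert Γ i (⇒R d) q = ⇒R (exchange (invert _ i d (↭-++-insert Γ _ q)) (++-swapʳ Γ _ _))
invert Γ i (∧⇒L p d) q with split (trans (↭-sym q) p)
invert Γ inv-∧⇒ (∧⇒L p d) q | same r = exchange d (++⁺ʳ _ (↭-sym r))
... | crossed Γ₀ r₁ r₂ =
  ∧⇒L (↭-++-insert Γ₀ _ r₁) (exchange (invert _ i d (↭-++-insert Γ₀ _ r₂)) (++-swapʳ Γ₀ _ _))
invert Γ i (∨⇒L p d) q with split (trans (↭-sym q) p)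
invert Γ inv-∨⇒ (∨⇒L p d) q | same r = exchange d (++⁺ʳ _ (↭-sym r))
... | crossed Γ₀ r₁ r₂ =
  ∨⇒L (↭-++-insert Γ₀ _ r₁) (exchange (invert _ i d (↭-++-insert Γ₀ _ r₂)) (++-swapʳ Γ₀ _ _))
invert Γ i (p⇒L p d) q with split₂ (trans (↭-sym q) p)
invert Γ () (p⇒L p d) q | first _
invert Γ inv-p⇒ (p⇒L p d) q | second r = exchange d (↭-sym (↭-snoc _ r))
... | crossed₂ Γ₀ r₁ r₂ =
  p⇒L (↭-++-insert Γ₀ _ r₁) (exchange (invert _ i d (↭-++-insert Γ₀ _ r₂)) (++-swapʳ Γ₀ _ _))
invert Γ i (⇒⇒L p d₁ d₂) q with split (trans (↭-sym q) p)
invert Γ inv-⇒⇒ (⇒⇒L p d₁ d₂) q | same r = exchange d₂ (++⁺ʳ _ (↭-sym r))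
... | crossed Γ₀ r₁ r₂ =
  ⇒⇒L (↭-++-insert Γ₀ _ r₁) (exchange (invert _ i d₁ (↭-++-insert Γ₀ _ r₂)) (++-swapʳ Γ₀ _ _))
      (exchange (invert _ i d₂ (↭-++-insert Γ₀ _ r₂)) (++-swapʳ Γ₀ _ _))
invert Γ i (□R d) q = □R (weaken d _ (□⁻¹-inverted i q))
invert Γ i (□⇒L p d₁ d₂) q with split (trans (↭-sym q) p)
invert Γ inv-□⇒ (□⇒L p d₁ d₂) q | same r = exchange d₂ (++⁺ʳ _ (↭-sym r))
... | crossed Γ₀ r₁ r₂ =
  □⇒L (↭-++-insert Γ₀ _ r₁) (weaken d₁ _ (□⁻¹-inverted i r₂))
      (exchange (invert _ i d₂ (↭-++-insert Γ₀ _ r₂)) (++-swapʳ Γ₀ _ _))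
invert Γ i (◇⇒L {Γ = Γ'} p d₁ d₂) q with split₂ (trans (↭-sym q) p)
invert Γ () (◇⇒L p d₁ d₂) q | first _
invert Γ inv-◇⇒ (◇⇒L p d₁ d₂) q | second r = exchange d₂ (↭-sym (↭-snoc _ r))
... | crossed₂ Γ₀ r₁ r₂ =
  ◇⇒L (↭-++-insert Γ₀ _ r₁) (weaken d₁ _ (↭-++-insert (□⁻¹ Γ') _ (□⁻¹-inverted i r₂)))
      (exchange (invert _ i d₂ (↭-++-insert Γ₀ _ r₂)) (++-swapʳ Γ₀ _ _))
invert Γ i (◇L {Γ = Γ'} p d) q with split (trans (↭-sym q) p)
invert Γ () (◇L p d) q | same _
... | crossed Γ₀ r₁ r₂ =
  ◇L (↭-++-insert Γ₀ _ r₁) (weaken d _ (↭-++-insert (□⁻¹ Γ') _ (□⁻¹-inverted i r₂)))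
invert Γ i (◇L' {Γ = Γ'} p d) q with split (trans (↭-sym q) p)
invert Γ () (◇L' p d) q | same _
... | crossed Γ₀ r₁ r₂ =
  ◇L' (↭-++-insert Γ₀ _ r₁) (weaken d _ (↭-++-insert (□⁻¹ Γ') _ (□⁻¹-inverted i r₂)))

invert₂ : ∀ {S Θ B Bs} {Δ : Succ S} Γ x → Invertible B Bs →
          S ⊢ Θ ⇒ Δ → Θ ↭ Γ ++ x ∷ B ∷ [] → S ⊢ Γ ++ x ∷ Bs ⇒ Δ
invert₂ {B = B} {Bs} Γ x i d q =
  exchange (invert (Γ ++ [ x ]) i d (trans q (↭-sym (++-assoc Γ [ x ] [ B ])))) (++-assoc Γ [ x ] Bs)

⇒L-Admissible : Sys → Fm → Set
⇒L-Admissible S φ =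
  ∀ {Γ ψ} {Δ : Succ S} → S ⊢ Γ ⇒ sing S φ → S ⊢ ψ ∷ Γ ⇒ Δ → S ⊢ Γ ++ [ φ ⇒' ψ ] ⇒ Δ

-- The induction hypothesis needed when φ is principal in ∧R, ∨R₁ or ∨R₂.
⇒L-Admissible-components : Sys → Fm → Set
⇒L-Admissible-components S (α ∧' β) = ⇒L-Admissible S α × ⇒L-Admissible S β
⇒L-Admissible-components S (α ∨' β) = ⇒L-Admissible S α × ⇒L-Admissible S β
⇒L-Admissible-components S _        = ⊤

sing-injective : ∀ S {φ ψ} → sing S φ ≡ sing S ψ → φ ≡ ψ
sing-injective CK eq   = eq
sing-injective WK refl = refl

⇒L-∧R : ∀ {S Θ α β ψ} {Δ : Succ S} → ⇒L-Admissible S α × ⇒L-Admissible S β →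
        S ⊢ Θ ⇒ sing S α → S ⊢ Θ ⇒ sing S β → S ⊢ ψ ∷ Θ ⇒ Δ → S ⊢ Θ ++ [ α ∧' β ⇒' ψ ] ⇒ Δ
⇒L-∧R {Θ = Θ} (hα , hβ) d₁ d₂ e = ∧⇒L ↭-refl (hα d₁ (exchange (hβ d₂ e) (↭-sym (∷↭∷ʳ _ Θ))))

⇒L-∨R₁ : ∀ {S Θ α β ψ} {Δ : Succ S} → ⇒L-Admissible S α × ⇒L-Admissible S β →
         S ⊢ Θ ⇒ sing S α → S ⊢ ψ ∷ Θ ⇒ Δ → S ⊢ Θ ++ [ α ∨' β ⇒' ψ ] ⇒ Δ
⇒L-∨R₁ {Θ = Θ} {α} {β} {ψ} (hα , _) d e =
  ∨⇒L ↭-refl (exchange (hα (weaken d [ β ⇒' ψ ] ↭-refl) (weaken e [ β ⇒' ψ ] ↭-refl))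
                       (trans (++-swapʳ Θ [ β ⇒' ψ ] [ α ⇒' ψ ]) (++-assoc Θ _ _)))

⇒L-∨R₂ : ∀ {S Θ α β ψ} {Δ : Succ S} → ⇒L-Admissible S α × ⇒L-Admissible S β →
         S ⊢ Θ ⇒ sing S β → S ⊢ ψ ∷ Θ ⇒ Δ → S ⊢ Θ ++ [ α ∨' β ⇒' ψ ] ⇒ Δ
⇒L-∨R₂ {Θ = Θ} {α} {ψ = ψ} (_ , hβ) d e =
  ∨⇒L ↭-refl (exchange (hβ (weaken d [ α ⇒' ψ ] ↭-refl) (weaken e [ α ⇒' ψ ] ↭-refl))
                       (++-assoc Θ _ _))

⇒L-◇L' : ∀ {Θ Γ γ} φ {ψ} {Δ : Maybe Fm} → Θ ↭ Γ ++ [ ◇ γ ] →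
         WK ⊢ □⁻¹ Γ ++ [ γ ] ⇒ ◇⁻¹ (just φ) → WK ⊢ ψ ∷ Θ ⇒ Δ → WK ⊢ Θ ++ [ φ ⇒' ψ ] ⇒ Δ
⇒L-◇L' (◇ α)    p d e = ◇⇒L (↭-snoc _ p) d (exchange e (↭-cons-snoc _ p))
-- Unless φ is a diamond, the premise of ◇L' has an empty succedent and absorbs any right side.
⇒L-◇L' (var _)  p d _ = weaken (weakenʳ (◇L' p d)) _ ↭-refl
⇒L-◇L' ⊥'       p d _ = weaken (weakenʳ (◇L' p d)) _ ↭-refl
⇒L-◇L' (_ ∧' _) p d _ = weaken (weakenʳ (◇L' p d)) _ ↭-refl
⇒L-◇L' (_ ∨' _) p d _ = weaken (weakenʳ (◇L' p d)) _ ↭-refl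
⇒L-◇L' (_ ⇒' _) p d _ = weaken (weakenʳ (◇L' p d)) _ ↭-refl
⇒L-◇L' (□ _)    p d _ = weaken (weakenʳ (◇L' p d)) _ ↭-refl

⇒L-by-derivation : ∀ {S Θ} {D : Succ S} φ → ⇒L-Admissible-components S φ →
                   S ⊢ Θ ⇒ D → D ≡ sing S φ →
                   ∀ {ψ} {Δ : Succ S} → S ⊢ ψ ∷ Θ ⇒ Δ → S ⊢ Θ ++ [ φ ⇒' ψ ] ⇒ Δ
⇒L-by-derivation φ h (⊥L {Γ = Γ} p) eq e = ⊥L (↭-++-insert Γ _ p)
⇒L-by-derivation {S} φ h (IdP p) eq e with refl ← sing-injective S eq =
  p⇒L (↭-snoc _ p) (exchange e (↭-cons-snoc _ p))
⇒L-by-derivation φ h (∧L {Γ = Γ} p d) eq e =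
  ∧L (↭-++-insert Γ _ p)
     (exchange (⇒L-by-derivation φ h d eq (invert (_ ∷ Γ) inv-∧ e (prep _ p))) (++-swapʳ Γ _ _))
⇒L-by-derivation {S} φ h (∧R d₁ d₂) eq e with refl ← sing-injective S eq = ⇒L-∧R h d₁ d₂ e
⇒L-by-derivation φ h (∨L {Γ = Γ} p d₁ d₂) eq e =
  ∨L (↭-++-insert Γ _ p)
     (exchange (⇒L-by-derivation φ h d₁ eq (invert (_ ∷ Γ) inv-∨₁ e (prep _ p))) (++-swapʳ Γ _ _))
     (exchange (⇒L-by-derivation φ h d₂ eq (invert (_ ∷ Γ) inv-∨₂ e (prep _ p))) (++-swapʳ Γ _ _))
⇒L-by-derivation {S} φ h (∨R₁ d) eq e with refl ← sing-injective S eq = ⇒L-∨R₁ h d e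
⇒L-by-derivation {S} φ h (∨R₂ d) eq e with refl ← sing-injective S eq = ⇒L-∨R₂ h d e
⇒L-by-derivation {S} {Θ} φ h (⇒R d) eq e with refl ← sing-injective S eq =
  ⇒⇒L ↭-refl (weaken (⇒R d) _ ↭-refl) (exchange e (∷↭∷ʳ _ Θ))
⇒L-by-derivation φ h (∧⇒L {Γ = Γ} p d) eq e =
  ∧⇒L (↭-++-insert Γ _ p)
      (exchange (⇒L-by-derivation φ h d eq (invert (_ ∷ Γ) inv-∧⇒ e (prep _ p))) (++-swapʳ Γ _ _))
⇒L-by-derivation φ h (∨⇒L {Γ = Γ} p d) eq e =
  ∨⇒L (↭-++-insert Γ _ p)
      (exchange (⇒L-by-derivation φ h d eq (invert (_ ∷ Γ) inv-∨⇒ e (prep _ p))) (++-swapʳ Γ _ _))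
⇒L-by-derivation φ h (p⇒L {Γ = Γ} {p = v} p d) eq e =
  p⇒L (↭-++-insert Γ _ p)
      (exchange (⇒L-by-derivation φ h d eq (invert₂ (_ ∷ Γ) (var v) inv-p⇒ e (prep _ p)))
                (++-swapʳ Γ _ _))
⇒L-by-derivation φ h (⇒⇒L {Γ = Γ} p d₁ d₂) eq e =
  ⇒⇒L (↭-++-insert Γ _ p) (weaken d₁ _ (++-swapʳ Γ _ _))
      (exchange (⇒L-by-derivation φ h d₂ eq (invert (_ ∷ Γ) inv-⇒⇒ e (prep _ p))) (++-swapʳ Γ _ _))
⇒L-by-derivation {S} {Θ} φ h (□R d) eq e with refl ← sing-injective S eq =
  □⇒L ↭-refl d (exchange e (∷↭∷ʳ _ Θ))
⇒L-by-derivation φ h (□⇒L {Γ = Γ} p d₁ d₂) eq e =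
  □⇒L (↭-++-insert Γ _ p) (weaken d₁ _ (↭-reflexive (□⁻¹-++ Γ _)))
      (exchange (⇒L-by-derivation φ h d₂ eq (invert (_ ∷ Γ) inv-□⇒ e (prep _ p))) (++-swapʳ Γ _ _))
⇒L-by-derivation φ h (◇⇒L {Γ = Γ} {γ = γ} p d₁ d₂) eq e =
  ◇⇒L (↭-++-insert Γ _ p) (weaken d₁ _ (□⁻¹-insert Γ _))
      (exchange (⇒L-by-derivation φ h d₂ eq (invert₂ (_ ∷ Γ) (◇ γ) inv-◇⇒ e (prep _ p)))
                (++-swapʳ Γ _ _))
⇒L-by-derivation φ h (◇L p d) refl e = ◇⇒L (↭-snoc _ p) d (exchange e (↭-cons-snoc _ p))
⇒L-by-derivation φ h (◇L' p d) refl e = ⇒L-◇L' φ p d e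

⇒L-admissible : ∀ {S} φ → ⇒L-Admissible S φ
⇒L-admissible φ d = ⇒L-by-derivation φ (components φ) d refl
  where
    components : ∀ {S} φ → ⇒L-Admissible-components S φ
    components (α ∧' β) = ⇒L-admissible α , ⇒L-admissible β
    components (α ∨' β) = ⇒L-admissible α , ⇒L-admissible β
    components (var _)  = tt
    components ⊥'       = tt
    components (_ ⇒' _) = tt
    components (□ _)    = tt
    components (◇ _)    = tt

identity : ∀ S φ Γ → S ⊢ Γ ++ [ φ ] ⇒ sing S φ
identity S (var _) Γ = IdP ↭-refl
identity S ⊥' Γ = ⊥L ↭-refl
identity S (α ∧' β) Γ =
  ∧L ↭-refl (∧R (weaken (identity S α Γ) [ β ] Γαβ↭)
                (weaken (identity S β Γ) [ α ] (trans Γαβ↭ (++-swapʳ Γ [ α ] [ β ]))))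
  where
    Γαβ↭ : Γ ++ α ∷ β ∷ [] ↭ (Γ ++ [ α ]) ++ [ β ]
    Γαβ↭ = ↭-sym (++-assoc Γ [ α ] [ β ])
identity S (α ∨' β) Γ = ∨L ↭-refl (∨R₁ (identity S α Γ)) (∨R₂ (identity S β Γ))
identity S (α ⇒' β) Γ =
  ⇒R (exchange (⇒L-admissible α (identity S α Γ)
                                (exchange (identity S β (Γ ++ [ α ])) (↭-sym (∷↭∷ʳ β _))))
               (++-swapʳ Γ [ α ] [ α ⇒' β ]))
identity S (□ α) Γ = □R (exchange (identity S α (□⁻¹ Γ)) (↭-reflexive (sym (□⁻¹-++ Γ [ □ α ]))))
identity CK (◇ α) Γ = ◇L ↭-refl (identity CK α (□⁻¹ Γ))
identity WK (◇ α) Γ = ◇L' ↭-refl (identity WK α (□⁻¹ Γ))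

lemma1 : (S : Sys) →
    (∀ (Γ Π : List Fm) (Δ : Succ S) → S ⊢ Γ ⇒ Δ → S ⊢ Γ ++ Π ⇒ Δ)
    × (∀ (Γ : List Fm) (φ : Fm) → S ⊢ Γ ++ [ φ ] ⇒ sing S φ)
    × (∀ (Γ : List Fm) (φ ψ : Fm) (Δ : Succ S) →
         S ⊢ Γ ⇒ sing S φ → S ⊢ ψ ∷ Γ ⇒ Δ → S ⊢ Γ ++ [ φ ⇒' ψ ] ⇒ Δ)
lemma1 S = (λ Γ Π Δ d → weaken d Π ↭-refl)
         , (λ Γ φ → identity S φ Γ)
         , (λ Γ φ ψ Δ → ⇒L-admissible φ)
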